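{- Let $n\geq 0$ be an integer and $G_n\in HL_n$. For every integer $g$ with $1\leq g\leq 2^n-1$, we have $f(g)=ng-2e_g\geq n$.
   Context: Hypercube-like networks (HL-networks) are defined recursively: $HL_0=\{K_1\}$, and for $n\geq 1$, $HL_n$ is the set of all graphs obtained from the disjoint union of two graphs $G_{n-1},G'_{n-1}\in HL_{n-1}$ by adding the edges of an arbitrary perfect matching between $V(G_{n-1})$ and $V(G'_{n-1})$. Every $G_n\in HL_n$ is $n$-regular with $2^n$ vertices. For $G_n\in HL_n$ and an integer $g$ with $1\le g\le 2^n$, $e_g$ denotes the maximum number of edges of a subgraph of $G_n$ induced by $g$ vertices, and $f(g)=ng-2e_g$. (It is known that if $g=\sum_{i=0}^s2^{t_i}$ with $t_0>t_1>\dots>t_s\ge 0$ is the binary expansion of $g$, then $e_g=\sum_{i=0}^st_i2^{t_i-1}+\sum_{i=0}^{s}i2^{t_i}$, independently of the choice of $G_n\in HL_n$.) -}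

module Defs where

open import Data.Nat using (ℕ; zero; suc; _+_; _*_; _≤_)
open import Data.Bool using (Bool; true; false; if_then_else_)
open import Data.Vec using (Vec; []; _∷_)
open import Data.Vec.Properties using (≡-dec)
open import Data.List using (List; []; _∷_; length)
open import Data.List.Relation.Unary.Unique.Propositional using (Unique)
open import Data.Product using (Σ; _×_; _,_)
open import Function.Bundles using (_↔_; Inverse)
open import Relation.Binary.PropositionalEquality using (_≡_)
open import Relation.Nullary.Decidable using (⌊_⌋)
import Data.Bool.Properties as BoolP

-- Vertices of a graph in HL_n are labelled by binary strings of length n:
-- the head bit tells in which of the two copies G_{n-1}, G'_{n-1} the vertex lies.
Vtx : ℕ → Set
Vtx n = Vec Bool n

_≟V_ : ∀ {n} (u v : Vtx n) → Bool
u ≟V v = ⌊ ≡-dec BoolP._≟_ u v ⌋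

-- A member of HL_n, recorded by its recursive construction:
-- HL_0 = {K_1}; a member of HL_{n+1} is two members of HL_n plus a
-- perfect matching between their vertex sets (= a bijection σ).
data HL : ℕ → Set where
  K₁   : HL 0
  join : ∀ {n} → HL n → HL n → (Vtx n ↔ Vtx n) → HL (suc n)

adj : ∀ {n} → HL n → Vtx n → Vtx n → Bool
adj K₁ [] [] = false
adj (join G G' σ) (false ∷ u) (false ∷ v) = adj G u v
adj (join G G' σ) (true ∷ u) (true ∷ v) = adj G' u v
adj (join G G' σ) (false ∷ u) (true ∷ v) = Inverse.to σ u ≟V v
adj (join G G' σ) (true ∷ u) (false ∷ v) = Inverse.to σ v ≟V u

countAdj : ∀ {n} → HL n → Vtx n → List (Vtx n) → ℕ
countAdj G v [] = 0
countAdj G v (w ∷ S) = (if adj G v w then 1 else 0) + countAdj G v S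

edgesIn : ∀ {n} → HL n → List (Vtx n) → ℕ
edgesIn G [] = 0
edgesIn G (v ∷ S) = countAdj G v S + edgesIn G S

IsEg : ∀ {n} → HL n → ℕ → ℕ → Set
IsEg {n} G g e =
  Σ (List (Vtx n)) (λ S → Unique S × length S ≡ g × edgesIn G S ≡ e)
  × (∀ (S : List (Vtx n)) → Unique S → length S ≡ g → edgesIn G S ≤ e)

-- Write D(S) for the number of edges leaving a vertex set S, so that n |S| = 2 e(S) + D(S).
-- For G = join G₀ G₁ σ, split S into its parts S₀, S₁ in the two copies and let c be the
-- number of matching edges between them. Since σ is a bijection, c ≤ |S₀| and c ≤ |S₁|,
-- and D(S) = (|S₀| - c + D(S₀)) + (|S₁| - c + D(S₁)). By induction D(Sᵢ) ≥ n - 1 whenever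
-- Sᵢ is neither empty nor everything, and a case split on which parts are empty or full
-- gives D(S) ≥ n.
module Submission where

open import Data.Nat using (ℕ; zero; suc; _+_; _*_; _^_; _≤_; _<_; z≤n; s≤s)
open import Data.Nat.Properties
open import Data.Nat.Tactic.RingSolver using (solve-∀)
open import Algebra.Properties.CommutativeSemigroup +-commutativeSemigroup using (x∙yz≈y∙xz)
open import Data.Bool using (Bool; true; false; if_then_else_)
import Data.Bool.Properties as BoolP
open import Data.Vec using ([]; _∷_)
open import Data.Vec.Properties using (≡-dec)
open import Data.List using (List; []; _∷_; length)
open import Data.List.Relation.Unary.All using (All; []; _∷_)
open import Data.List.Relation.Unary.AllPairs using ([]; _∷_)
open import Data.List.Relation.Unary.Unique.Propositional using (Unique)
open import Data.Product using (_×_; _,_; proj₁; proj₂; ∃-syntax)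
open import Data.Sum using (inj₁; inj₂)
open import Data.Empty using (⊥-elim)
open import Function.Bundles using (_↔_; Inverse; Injection)
open import Function.Properties.Inverse using (↔⇒↣)
open import Relation.Nullary using (¬_; yes; no)
open import Relation.Binary.PropositionalEquality
open import Defs

private
  variable
    A B : Set

≟V⇒≡ : ∀ {n} {u v : Vtx n} → u ≟V v ≡ true → u ≡ v
≟V⇒≡ {u = u} {v} eq with ≡-dec BoolP._≟_ u v
... | yes u≡v = u≡v

count : (A → Bool) → List A → ℕ
count p [] = 0
count p (x ∷ xs) = (if p x then 1 else 0) + count p xs

count-≤1 : {p : A → Bool} → (∀ {x y} → p x ≡ true → p y ≡ true → x ≡ y) →
           ∀ {xs} → Unique xs → count p xs ≤ 1
count-≤1 {p = p} p-injective = go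
  where
  none : ∀ {x xs} → p x ≡ true → All (λ y → ¬ x ≡ y) xs → count p xs ≡ 0
  none px [] = refl
  none {xs = y ∷ _} px (x≢y ∷ x≢ys) with p y in py
  ... | true  = ⊥-elim (x≢y (p-injective px py))
  ... | false = none px x≢ys

  go : ∀ {xs} → Unique xs → count p xs ≤ 1
  go [] = z≤n
  go {x ∷ _} (x∉xs ∷ uniq) with p x in px
  ... | true  = s≤s (≤-reflexive (none px x∉xs))
  ... | false = go uniq

pairs : (A → B → Bool) → List A → List B → ℕ
pairs R [] ys = 0
pairs R (x ∷ xs) ys = count (R x) ys + pairs R xs ys

pairs-∷ʳ : (R : A → B → Bool) (xs : List A) (y : B) (ys : List B) →
           pairs R xs (y ∷ ys) ≡ count (λ x → R x y) xs + pairs R xs ys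
pairs-∷ʳ R [] y ys = refl
pairs-∷ʳ R (x ∷ xs) y ys rewrite pairs-∷ʳ R xs y ys =
  interchange (if R x y then 1 else 0) (count (R x) ys) (count (λ x → R x y) xs) (pairs R xs ys)
  where
  interchange : ∀ a b c d → a + b + (c + d) ≡ a + c + (b + d)
  interchange = solve-∀

pairs-≤ˡ : (R : A → B → Bool) (xs : List A) (ys : List B) →
           (∀ x → count (R x) ys ≤ 1) → pairs R xs ys ≤ length xs
pairs-≤ˡ R [] ys functional = z≤n
pairs-≤ˡ R (x ∷ xs) ys functional = +-mono-≤ (functional x) (pairs-≤ˡ R xs ys functional)

pairs-≤ʳ : (R : A → B → Bool) (xs : List A) (ys : List B) →
           (∀ y → count (λ x → R x y) xs ≤ 1) → pairs R xs ys ≤ length ys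
pairs-≤ʳ R xs [] injective = ≤-reflexive (pairs-[]ʳ xs)
  where
  pairs-[]ʳ : ∀ xs → pairs R xs [] ≡ 0
  pairs-[]ʳ [] = refl
  pairs-[]ʳ (_ ∷ xs) = pairs-[]ʳ xs
pairs-≤ʳ R xs (y ∷ ys) injective rewrite pairs-∷ʳ R xs y ys =
  +-mono-≤ (injective y) (pairs-≤ʳ R xs ys injective)

side : ∀ {m} → Bool → List (Vtx (suc m)) → List (Vtx m)
side b [] = []
side b ((h ∷ u) ∷ S) with h BoolP.≟ b
... | yes _ = u ∷ side b S
... | no _  = side b S

length-side : ∀ {m} (S : List (Vtx (suc m))) → length S ≡ length (side false S) + length (side true S)
length-side [] = refl
length-side ((false ∷ u) ∷ S) = cong suc (length-side S)
length-side ((true ∷ u) ∷ S) =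
  trans (cong suc (length-side S)) (sym (+-suc (length (side false S)) (length (side true S))))

Unique-side : ∀ {m} b {S : List (Vtx (suc m))} → Unique S → Unique (side b S)
Unique-side b [] = []
Unique-side b {(h ∷ u) ∷ S} (u∉S ∷ uniq) with h BoolP.≟ b
... | yes refl = All-side S u∉S ∷ Unique-side b uniq
  where
  All-side : ∀ S → All (λ w → ¬ (b ∷ u) ≡ w) S → All (λ w → ¬ u ≡ w) (side b S)
  All-side [] [] = []
  All-side ((h′ ∷ v) ∷ S) (u≢v ∷ u∉S) with h′ BoolP.≟ b
  ... | yes refl = (λ u≡v → u≢v (cong (b ∷_) u≡v)) ∷ All-side S u∉S
  ... | no _     = All-side S u∉S
... | no _ = Unique-side b uniq

matched : ∀ {m} → (Vtx m ↔ Vtx m) → Vtx m → Vtx m → Bool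
matched σ w v = Inverse.to σ w ≟V v

module _ {m} (G₀ G₁ : HL m) (σ : Vtx m ↔ Vtx m) where

  countAdj-join-false : ∀ u S → countAdj (join G₀ G₁ σ) (false ∷ u) S
                        ≡ countAdj G₀ u (side false S) + count (matched σ u) (side true S)
  countAdj-join-false u [] = refl
  countAdj-join-false u ((false ∷ v) ∷ S) rewrite countAdj-join-false u S =
    sym (+-assoc (if adj G₀ u v then 1 else 0) (countAdj G₀ u (side false S)) (count (matched σ u) (side true S)))
  countAdj-join-false u ((true ∷ v) ∷ S) rewrite countAdj-join-false u S =
    x∙yz≈y∙xz (if matched σ u v then 1 else 0) (countAdj G₀ u (side false S)) (count (matched σ u) (side true S))

  countAdj-join-true : ∀ u S → countAdj (join G₀ G₁ σ) (true ∷ u) S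
                       ≡ count (λ w → matched σ w u) (side false S) + countAdj G₁ u (side true S)
  countAdj-join-true u [] = refl
  countAdj-join-true u ((false ∷ v) ∷ S) rewrite countAdj-join-true u S =
    sym (+-assoc (if matched σ v u then 1 else 0) (count (λ w → matched σ w u) (side false S)) (countAdj G₁ u (side true S)))
  countAdj-join-true u ((true ∷ v) ∷ S) rewrite countAdj-join-true u S =
    x∙yz≈y∙xz (if adj G₁ u v then 1 else 0) (count (λ w → matched σ w u) (side false S)) (countAdj G₁ u (side true S))

  edgesIn-join : ∀ S → edgesIn (join G₀ G₁ σ) S
                 ≡ edgesIn G₀ (side false S) + edgesIn G₁ (side true S) + pairs (matched σ) (side false S) (side true S)
  edgesIn-join [] = refl
  edgesIn-join ((false ∷ u) ∷ S) rewrite countAdj-join-false u S | edgesIn-join S =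
    reassoc (countAdj G₀ u (side false S)) (count (matched σ u) (side true S))
            (edgesIn G₀ (side false S)) (edgesIn G₁ (side true S)) (pairs (matched σ) (side false S) (side true S))
    where
    reassoc : ∀ a b e₀ e₁ c → a + b + (e₀ + e₁ + c) ≡ a + e₀ + e₁ + (b + c)
    reassoc = solve-∀
  edgesIn-join ((true ∷ u) ∷ S)
    rewrite countAdj-join-true u S | edgesIn-join S | pairs-∷ʳ (matched σ) (side false S) u (side true S) =
    reassoc (count (λ w → matched σ w u) (side false S)) (countAdj G₁ u (side true S))
            (edgesIn G₀ (side false S)) (edgesIn G₁ (side true S)) (pairs (matched σ) (side false S) (side true S))
    where
    reassoc : ∀ a b e₀ e₁ c → a + b + (e₀ + e₁ + c) ≡ e₀ + (b + e₁) + (a + c)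
    reassoc = solve-∀

pairs-matched-≤ˡ : ∀ {m} (σ : Vtx m ↔ Vtx m) T₀ T₁ → Unique T₁ → pairs (matched σ) T₀ T₁ ≤ length T₀
pairs-matched-≤ˡ σ T₀ T₁ uniq = pairs-≤ˡ (matched σ) T₀ T₁ (λ w → count-≤1 (λ p q → trans (sym (≟V⇒≡ p)) (≟V⇒≡ q)) uniq)

pairs-matched-≤ʳ : ∀ {m} (σ : Vtx m ↔ Vtx m) T₀ T₁ → Unique T₀ → pairs (matched σ) T₀ T₁ ≤ length T₁
pairs-matched-≤ʳ σ T₀ T₁ uniq = pairs-≤ʳ (matched σ) T₀ T₁ (λ v → count-≤1 (λ p q → Injection.injective (↔⇒↣ σ) (trans (≟V⇒≡ p) (sym (≟V⇒≡ q)))) uniq)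

countAdj-K₁ : ∀ S → countAdj K₁ [] S ≡ 0
countAdj-K₁ [] = refl
countAdj-K₁ ([] ∷ S) = countAdj-K₁ S

edgesIn-K₁ : ∀ S → edgesIn K₁ S ≡ 0
edgesIn-K₁ [] = refl
edgesIn-K₁ ([] ∷ S) rewrite countAdj-K₁ S = edgesIn-K₁ S

2^suc : ∀ m → 2 ^ suc m ≡ 2 ^ m + 2 ^ m
2^suc m = cong (2 ^ m +_) (+-identityʳ (2 ^ m))

Unique⇒length≤2^ : ∀ {n} {S : List (Vtx n)} → Unique S → length S ≤ 2 ^ n
Unique⇒length≤2^ {zero} {[]} _ = z≤n
Unique⇒length≤2^ {zero} {[] ∷ []} _ = s≤s z≤n
Unique⇒length≤2^ {zero} {[] ∷ [] ∷ _} ((x≢y ∷ _) ∷ _) = ⊥-elim (x≢y refl)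
Unique⇒length≤2^ {suc m} {S} uniq = begin
  length S                                     ≡⟨ length-side S ⟩
  length (side false S) + length (side true S) ≤⟨ +-mono-≤ (Unique⇒length≤2^ (Unique-side false uniq))
                                                           (Unique⇒length≤2^ (Unique-side true uniq)) ⟩
  2 ^ m + 2 ^ m                                ≡⟨ 2^suc m ⟨
  2 ^ suc m                                    ∎
  where open ≤-Reasoning

m<2^m : ∀ m → m < 2 ^ m
m<2^m zero = s≤s z≤n
m<2^m (suc m) = ≤-trans (+-mono-<-≤ (m^n>0 2 m) (m<2^m m)) (≤-reflexive (sym (2^suc m)))

handshake-join : ∀ m {a b c x y e₀ e₁ D₀ D₁} → m * a ≡ 2 * e₀ + D₀ → m * b ≡ 2 * e₁ + D₁ →
                 c + x ≡ a → c + y ≡ b → suc m * (a + b) ≡ 2 * (e₀ + e₁ + c) + ((x + D₀) + (y + D₁))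
handshake-join m {c = c} {x} {y} {e₀} {e₁} {D₀} {D₁} hs₀ hs₁ refl refl = begin
  suc m * ((c + x) + (c + y))                              ≡⟨ expand m (c + x) (c + y) ⟩
  m * (c + x) + m * (c + y) + ((c + x) + (c + y))          ≡⟨ cong₂ (λ l r → l + r + ((c + x) + (c + y))) hs₀ hs₁ ⟩
  (2 * e₀ + D₀) + (2 * e₁ + D₁) + ((c + x) + (c + y))      ≡⟨ regroup e₀ e₁ c x y D₀ D₁ ⟩
  2 * (e₀ + e₁ + c) + ((x + D₀) + (y + D₁))                ∎
  where
  open ≡-Reasoning
  expand : ∀ m a b → suc m * (a + b) ≡ m * a + m * b + (a + b)
  expand = solve-∀
  regroup : ∀ e₀ e₁ c x y D₀ D₁ →
            (2 * e₀ + D₀) + (2 * e₁ + D₁) + ((c + x) + (c + y)) ≡ 2 * (e₀ + e₁ + c) + ((x + D₀) + (y + D₁))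
  regroup = solve-∀

boundary-step-ordered : ∀ m {a b c x y D₀ D₁} → a ≤ b → b ≤ 2 ^ m → c + x ≡ a → c + y ≡ b →
                  (1 ≤ a → a < 2 ^ m → m ≤ D₀) → (1 ≤ b → b < 2 ^ m → m ≤ D₁) →
                  1 ≤ a + b → a + b < 2 ^ m + 2 ^ m → suc m ≤ (x + D₀) + (y + D₁)
boundary-step-ordered m {zero} {c = c} {x} {D₀ = D₀} {D₁} _ b≤2^m c+x≡0 c+y≡b _ iso₁ 1≤b _
  with m+n≡0⇒m≡0 c c+x≡0
... | refl with c+y≡b
... | refl with m≤n⇒m<n∨m≡n b≤2^m
... | inj₁ b<2^m = ≤-trans (+-mono-<-≤ 1≤b (iso₁ 1≤b b<2^m)) (m≤n+m _ (x + D₀))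
... | inj₂ refl  = ≤-trans (m<2^m m) (≤-trans (m≤m+n (2 ^ m) D₁) (m≤n+m _ (x + D₀)))
boundary-step-ordered m {suc a} {_} {c} {x} {y} {D₀} {D₁} a≤b b≤2^m c+x≡a c+y≡b iso₀ iso₁ _ a+b<
  with m≤n⇒m<n∨m≡n b≤2^m
... | inj₁ b<2^m = begin-strict
  m           <⟨ m<m+n m (exponent-pos a<2^m) ⟩
  m + m       ≤⟨ +-mono-≤ (iso₀ (s≤s z≤n) a<2^m) (iso₁ (≤-trans (s≤s z≤n) a≤b) b<2^m) ⟩
  D₀ + D₁     ≤⟨ +-mono-≤ (m≤n+m D₀ x) (m≤n+m D₁ y) ⟩
  (x + D₀) + (y + D₁) ∎
  where
  open ≤-Reasoning
  a<2^m : suc a < 2 ^ m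
  a<2^m = ≤-<-trans a≤b b<2^m
  exponent-pos : ∀ {m} → suc a < 2 ^ m → 0 < m
  exponent-pos {zero} (s≤s ())
  exponent-pos {suc m} _ = s≤s z≤n
... | inj₂ refl = begin-strict
  m                   <⟨ +-mono-<-≤ (≤-trans (s≤s z≤n) x<y) (iso₀ (s≤s z≤n) (+-cancelʳ-< (2 ^ m) (suc a) (2 ^ m) a+b<)) ⟩
  y + D₀              ≡⟨ +-comm y D₀ ⟩
  D₀ + y              ≤⟨ +-mono-≤ (m≤n+m D₀ x) (m≤m+n y D₁) ⟩
  (x + D₀) + (y + D₁) ∎
  where
  open ≤-Reasoning
  -- c ≤ a < b: the full side has an unmatched vertex
  x<y : x < y
  x<y = +-cancelˡ-< c x y (subst₂ _<_ (sym c+x≡a) (sym c+y≡b) (+-cancelʳ-< (2 ^ m) (suc a) (2 ^ m) a+b<))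

boundary-step : ∀ m {a b c x y D₀ D₁} → a ≤ 2 ^ m → b ≤ 2 ^ m → c + x ≡ a → c + y ≡ b →
                (1 ≤ a → a < 2 ^ m → m ≤ D₀) → (1 ≤ b → b < 2 ^ m → m ≤ D₁) →
                1 ≤ a + b → a + b < 2 ^ suc m → suc m ≤ (x + D₀) + (y + D₁)
boundary-step m {a} {b} {c} {x} {y} {D₀} {D₁} a≤2^m b≤2^m c+x≡a c+y≡b iso₀ iso₁ 1≤a+b a+b<
  with ≤-total a b
... | inj₁ a≤b = boundary-step-ordered m {c = c} {x} {y} a≤b b≤2^m c+x≡a c+y≡b iso₀ iso₁ 1≤a+b (subst (a + b <_) (2^suc m) a+b<)
... | inj₂ b≤a = subst (suc m ≤_) (+-comm (y + D₁) (x + D₀))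
  (boundary-step-ordered m {c = c} {y} {x} b≤a a≤2^m c+y≡b c+x≡a iso₁ iso₀ (subst (1 ≤_) (+-comm a b) 1≤a+b)
                   (subst₂ _<_ (+-comm a b) (2^suc m) a+b<))

Isoperimetric : ∀ {n} → HL n → List (Vtx n) → Set
Isoperimetric {n} G S =
  ∃[ D ] n * length S ≡ 2 * edgesIn G S + D × (1 ≤ length S → length S < 2 ^ n → n ≤ D)

Isoperimetric-join : ∀ {m} (G₀ G₁ : HL m) σ {S} → Unique S →
                     Isoperimetric G₀ (side false S) → Isoperimetric G₁ (side true S) →
                     Isoperimetric (join G₀ G₁ σ) S
Isoperimetric-join {m} G₀ G₁ σ {S} uniq (D₀ , hs₀ , iso₀) (D₁ , hs₁ , iso₁) =
  (x + D₀) + (y + D₁) , handshake , isoperimetric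
  where
  S₀ S₁ : List (Vtx m)
  S₀ = side false S
  S₁ = side true S
  uniq₀ : Unique S₀
  uniq₀ = Unique-side false uniq
  uniq₁ : Unique S₁
  uniq₁ = Unique-side true uniq
  c : ℕ
  c = pairs (matched σ) S₀ S₁
  unmatched₀ : ∃[ x ] c + x ≡ length S₀
  unmatched₀ = m≤n⇒∃[o]m+o≡n (pairs-matched-≤ˡ σ S₀ S₁ uniq₁)
  unmatched₁ : ∃[ y ] c + y ≡ length S₁
  unmatched₁ = m≤n⇒∃[o]m+o≡n (pairs-matched-≤ʳ σ S₀ S₁ uniq₀)
  x y : ℕ
  x = proj₁ unmatched₀
  y = proj₁ unmatched₁
  handshake : suc m * length S ≡ 2 * edgesIn (join G₀ G₁ σ) S + ((x + D₀) + (y + D₁))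
  handshake rewrite length-side S | edgesIn-join G₀ G₁ σ S =
    handshake-join m {c = c} {e₀ = edgesIn G₀ S₀} {e₁ = edgesIn G₁ S₁} hs₀ hs₁ (proj₂ unmatched₀) (proj₂ unmatched₁)
  isoperimetric : 1 ≤ length S → length S < 2 ^ suc m → suc m ≤ (x + D₀) + (y + D₁)
  isoperimetric rewrite length-side S =
    boundary-step m {c = c} (Unique⇒length≤2^ uniq₀) (Unique⇒length≤2^ uniq₁)
                  (proj₂ unmatched₀) (proj₂ unmatched₁) iso₀ iso₁

isoperimetric : ∀ n (G : HL n) {S : List (Vtx n)} → Unique S → Isoperimetric G S
isoperimetric zero K₁ {S} _ rewrite edgesIn-K₁ S = 0 , refl , λ _ _ → z≤n
isoperimetric (suc m) (join G₀ G₁ σ) uniq =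
  Isoperimetric-join G₀ G₁ σ uniq (isoperimetric m G₀ (Unique-side false uniq)) (isoperimetric m G₁ (Unique-side true uniq))

lemma2p4 : (n : ℕ) (G : HL n) (g e : ℕ) → 1 ≤ g → g < 2 ^ n → IsEg G g e → n + 2 * e ≤ n * g
lemma2p4 n G g e 1≤g g<2^n ((S , uniq , refl , refl) , _) with isoperimetric n G uniq
... | D , handshake , isoperimetric = begin
  n + 2 * edgesIn G S ≤⟨ +-monoˡ-≤ (2 * edgesIn G S) (isoperimetric 1≤g g<2^n) ⟩
  D + 2 * edgesIn G S ≡⟨ +-comm D (2 * edgesIn G S) ⟩
  2 * edgesIn G S + D ≡⟨ handshake ⟨
  n * length S        ∎
  where open ≤-Reasoning
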